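{- Let $(A,\wedge)$ be a meet-semilattice with natural order $\le$ and greatest element $1$, and let $\to$ be a binary operation on $A$. Then $(A,\to,1)$ is a wBCK*-algebra if and only if for all $x,y,z\in A$: (1) $x\le (x\to y)\to y$; (2) $1\to x=x$; (3) $(x\wedge y)\to y=1$; (4) $x\to z\le (x\wedge y)\to z$.
   Context: A wBCK*-algebra is an algebra $(A,\to,1)$ where $A$ is a poset with order $\le$ and greatest element $1$, $x\le y$ iff $x\to y=1$, and for all $x,y,z$: if $x\le y\to z$ then $y\le x\to z$. -}

module Defs where

open import Level using (_⊔_)
open import Data.Product using (_×_)
open import Relation.Binary.Core using (Rel)
open import Algebra.Core using (Op₂)
open import Algebra.Definitions using (Congruent₂)
open import Relation.Binary.Lattice.Bundles using (BoundedMeetSemilattice)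

-- Here the poset and its top element are those of the given bounded
-- meet-semilattice (i.e. its natural order, whose greatest element is ⊤).
record IsWBCK* {c ℓ₁ ℓ₂} (L : BoundedMeetSemilattice c ℓ₁ ℓ₂)
               (_⇒_ : Op₂ (BoundedMeetSemilattice.Carrier L)) : Set (c ⊔ ℓ₁ ⊔ ℓ₂) where
  open BoundedMeetSemilattice L
  field
    ≤⇒⇒≈⊤    : ∀ x y → x ≤ y → (x ⇒ y) ≈ ⊤
    ⇒≈⊤⇒≤    : ∀ x y → (x ⇒ y) ≈ ⊤ → x ≤ y
    exchange : ∀ x y z → x ≤ (y ⇒ z) → y ≤ (x ⇒ z)

record Conditions {c ℓ₁ ℓ₂} (L : BoundedMeetSemilattice c ℓ₁ ℓ₂)
                  (_⇒_ : Op₂ (BoundedMeetSemilattice.Carrier L)) : Set (c ⊔ ℓ₁ ⊔ ℓ₂) where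
  open BoundedMeetSemilattice L
  field
    cond1 : ∀ x y → x ≤ ((x ⇒ y) ⇒ y)
    cond2 : ∀ x → (⊤ ⇒ x) ≈ x
    cond3 : ∀ x y → ((x ∧ y) ⇒ y) ≈ ⊤
    cond4 : ∀ x y z → (x ⇒ z) ≤ ((x ∧ y) ⇒ z)

module Submission where

-- Both directions pass through one intermediate property:
-- the implication is antitone in its first argument,
--   a ≤ b  →  (b ⇒ z) ≤ (a ⇒ z).
-- In a wBCK*-algebra, exchange applied to  x ⇒ y ≤ x ⇒ y  gives (1),
-- and then (1) plus exchange yields antitonicity; (4) is antitonicity at
-- x ∧ y ≤ x.  Condition (2) follows from (1) with x ⇒ x ≈ ⊤, and (3) is the
-- defining law "x ≤ y implies x ⇒ y ≈ ⊤" at x ∧ y ≤ y.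
-- Conversely, from (1)–(4): antitonicity is (4) read at a ∧ b ≈ a; the law
-- x ≤ y ⇒ (x ⇒ y) ≈ ⊤ is (3) at x ∧ y ≈ x; (x ⇒ y) ≈ ⊤ gives x ≤ y via
-- x ≤ (x ⇒ y) ⇒ y ≈ ⊤ ⇒ y ≈ y by (1), (2); and exchange is (1) followed
-- by antitonicity.

open import Defs
open import Data.Product using (_×_; _,_)
open import Algebra.Core using (Op₂)
open import Algebra.Definitions using (Congruent₂)
open import Relation.Binary.Lattice.Bundles using (BoundedMeetSemilattice)
import Relation.Binary.Lattice.Properties.MeetSemilattice as MeetProperties

module WBCK*Characterisation {c ℓ₁ ℓ₂} (L : BoundedMeetSemilattice c ℓ₁ ℓ₂)
    (_⇒_ : Op₂ (BoundedMeetSemilattice.Carrier L))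
    (⇒-cong : Congruent₂ (BoundedMeetSemilattice._≈_ L) _⇒_) where

  open BoundedMeetSemilattice L
  open MeetProperties meetSemilattice using (y≤x⇒x∧y≈y; ∧-comm)

  ⊤≤⇒≈⊤ : ∀ {a} → ⊤ ≤ a → a ≈ ⊤
  ⊤≤⇒≈⊤ {a} = antisym (maximum a)

  ≈⊤⇒⊤≤ : ∀ {a} → a ≈ ⊤ → ⊤ ≤ a
  ≈⊤⇒⊤≤ a≈⊤ = reflexive (Eq.sym a≈⊤)

  ≤⇒∧≈ : ∀ {x y} → x ≤ y → (x ∧ y) ≈ x
  ≤⇒∧≈ {x} {y} x≤y = Eq.trans (∧-comm x y) (y≤x⇒x∧y≈y x≤y)

  ⇒-congˡ : ∀ {a b} z → a ≈ b → (a ⇒ z) ≈ (b ⇒ z)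
  ⇒-congˡ z a≈b = ⇒-cong a≈b Eq.refl

  Antitoneˡ : Set _
  Antitoneˡ = ∀ {a b} z → a ≤ b → (b ⇒ z) ≤ (a ⇒ z)

  module FromWBCK* (w : IsWBCK* L _⇒_) where
    open IsWBCK* w

    -- Condition (1): exchange applied to the trivial x ⇒ y ≤ x ⇒ y.
    ≤⇒⇒⇒ : ∀ x y → x ≤ ((x ⇒ y) ⇒ y)
    ≤⇒⇒⇒ x y = exchange (x ⇒ y) x y refl

    antitoneˡ : Antitoneˡ
    antitoneˡ {a} {b} z a≤b = exchange a (b ⇒ z) z (trans a≤b (≤⇒⇒⇒ b z))

    -- Condition (2): ⊤ ⇒ x ≤ x since (⊤ ⇒ x) ⇒ x ≈ ⊤ by (1), and
    -- x ≤ ⊤ ⇒ x by exchange from ⊤ ≤ x ⇒ x.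
    ⊤⇒-identity : ∀ x → (⊤ ⇒ x) ≈ x
    ⊤⇒-identity x = antisym
      (⇒≈⊤⇒≤ (⊤ ⇒ x) x (⊤≤⇒≈⊤ (≤⇒⇒⇒ ⊤ x)))
      (exchange ⊤ x x (≈⊤⇒⊤≤ (≤⇒⇒≈⊤ x x refl)))

    conditions : Conditions L _⇒_
    conditions = record
      { cond1 = ≤⇒⇒⇒
      ; cond2 = ⊤⇒-identity
      ; cond3 = λ x y → ≤⇒⇒≈⊤ (x ∧ y) y (x∧y≤y x y)
      ; cond4 = λ x y z → antitoneˡ z (x∧y≤x x y)
      }

  module FromConditions (cd : Conditions L _⇒_) where
    open Conditions cd

    -- (4) at a ∧ b ≈ a.
    antitoneˡ : Antitoneˡ
    antitoneˡ {a} {b} z a≤b =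
      trans (cond4 b a z) (reflexive (⇒-congˡ z (y≤x⇒x∧y≈y a≤b)))

    -- (3) at x ∧ y ≈ x.
    ≤⇒⇒≈⊤ : ∀ x y → x ≤ y → (x ⇒ y) ≈ ⊤
    ≤⇒⇒≈⊤ x y x≤y = Eq.trans (⇒-congˡ y (Eq.sym (≤⇒∧≈ x≤y))) (cond3 x y)

    -- x ≤ (x ⇒ y) ⇒ y ≈ ⊤ ⇒ y ≈ y, by (1) and (2).
    ⇒≈⊤⇒≤ : ∀ x y → (x ⇒ y) ≈ ⊤ → x ≤ y
    ⇒≈⊤⇒≤ x y x⇒y≈⊤ =
      trans (cond1 x y) (reflexive (Eq.trans (⇒-congˡ y x⇒y≈⊤) (cond2 y)))

    -- y ≤ (y ⇒ z) ⇒ z ≤ x ⇒ z, by (1) and antitonicity.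
    exchange : ∀ x y z → x ≤ (y ⇒ z) → y ≤ (x ⇒ z)
    exchange x y z x≤y⇒z = trans (cond1 y z) (antitoneˡ z x≤y⇒z)

    isWBCK* : IsWBCK* L _⇒_
    isWBCK* = record
      { ≤⇒⇒≈⊤ = ≤⇒⇒≈⊤ ; ⇒≈⊤⇒≤ = ⇒≈⊤⇒≤ ; exchange = exchange }

theorem5p2 : ∀ {c ℓ₁ ℓ₂} (L : BoundedMeetSemilattice c ℓ₁ ℓ₂)
             (_⇒_ : Op₂ (BoundedMeetSemilattice.Carrier L)) →
             Congruent₂ (BoundedMeetSemilattice._≈_ L) _⇒_ →
             (IsWBCK* L _⇒_ → Conditions L _⇒_) × (Conditions L _⇒_ → IsWBCK* L _⇒_)
theorem5p2 L _⇒_ ⇒-cong =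
  FromWBCK*.conditions , FromConditions.isWBCK*
  where open WBCK*Characterisation L _⇒_ ⇒-cong
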